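{- The growth function $g_M:\mathbb{N}_+\to\mathbb{N}$ of every string multiway system $M$ is primitive recursive.
   Context: A (string) multiway system is a triple $M=(R,s_{\text{init}},\Sigma)$: a finite alphabet $\Sigma$, a finite set $R$ of replacement rules $r\to t$ with $r,t\in\Sigma^*$, and an initial string $s_{\text{init}}\in\Sigma^*$. Its states graph has as vertices the strings reachable from $s_{\text{init}}$, with an edge $u\to v$ if $v$ arises from $u$ by replacing one occurrence of some $r$ by the corresponding $t$. The growth function $g_M(n)$ is the number of states first appearing in generation $n$ of the evolution (generation 1 is $\{s_{\text{init}}\}$; generation $n$ consists of the states whose shortest path from $s_{\text{init}}$ has length $n-1$). -}

module Defs where

open import Data.Nat using (ℕ; zero; suc; _<_)
open import Data.Fin using (Fin)
open import Data.Vec using (Vec; []; _∷_; lookup)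
open import Data.List using (List; _++_; length)
open import Data.List.Membership.Propositional using (_∈_)
open import Data.List.Relation.Unary.Unique.Propositional using (Unique)
open import Data.Product using (_×_; _,_; ∃; ∃-syntax; Σ)
open import Relation.Binary.PropositionalEquality using (_≡_)
open import Relation.Nullary using (¬_)
open import Function.Bundles using (_⇔_)

data PR : ℕ → Set where
  zeroF : ∀ {n} → PR n
  succF : PR 1
  proj  : ∀ {n} → Fin n → PR n
  comp  : ∀ {m n} → PR m → Vec (PR n) m → PR n
  prec  : ∀ {n} → PR n → PR (suc (suc n)) → PR (suc n)

mutual
  eval : ∀ {n} → PR n → Vec ℕ n → ℕ
  eval zeroF xs = 0
  eval succF (x ∷ []) = suc x
  eval (proj i) xs = lookup xs i
  eval (comp f gs) xs = eval f (evalVec gs xs)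
  eval (prec f g) (zero ∷ xs) = eval f xs
  eval (prec f g) (suc y ∷ xs) = eval g (y ∷ eval (prec f g) (y ∷ xs) ∷ xs)

  evalVec : ∀ {m n} → Vec (PR n) m → Vec ℕ n → Vec ℕ m
  evalVec [] xs = []
  evalVec (g ∷ gs) xs = eval g xs ∷ evalVec gs xs

PrimRecOnPos : (ℕ → ℕ) → Set
PrimRecOnPos g = Σ (PR 1) (λ f → (n : ℕ) → eval f (suc n ∷ []) ≡ g (suc n))

Str : ℕ → Set
Str k = List (Fin k)

record MultiwaySystem (k : ℕ) : Set where
  field
    rules : List (Str k × Str k)
    init  : Str k
open MultiwaySystem public

Step : ∀ {k} → MultiwaySystem k → Str k → Str k → Set
Step M u v = ∃[ r ] ∃[ t ] ∃[ x ] ∃[ y ]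
  ((r , t) ∈ rules M × u ≡ x ++ r ++ y × v ≡ x ++ t ++ y)

data Path {k} (M : MultiwaySystem k) : ℕ → Str k → Str k → Set where
  here : ∀ {u} → Path M 0 u u
  step : ∀ {m u v w} → Path M m u v → Step M v w → Path M (suc m) u w

Dist : ∀ {k} → MultiwaySystem k → Str k → ℕ → Set
Dist M s m = Path M m (init M) s × (∀ j → j < m → ¬ Path M j (init M) s)

InGeneration : ∀ {k} → MultiwaySystem k → ℕ → Str k → Set
InGeneration M zero s = Data.Empty.⊥ where import Data.Empty
InGeneration M (suc n) s = Dist M s n

GrowthIs : ∀ {k} → MultiwaySystem k → ℕ → ℕ → Set
GrowthIs M n c = ∃[ L ] (Unique L × length L ≡ c × (∀ s → (s ∈ L) ⇔ InGeneration M n s))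

module Submission where

-- Strings over an alphabet of size K ≥ 1 are coded by numbers (bijective base K). A rewriting
-- step u → v splits u and v as x ++ r ++ y and x ++ t ++ y for a rule r → t, and the length and
-- code of x and the code of y are bounded by the code of u, so the one-step relation has an
-- indicator made of bounded sums. A step lengthens a string by at most the longest right-hand
-- side D, so the strings reachable in j steps have codes below an explicit bound, and their set
-- can be carried as a single number (a bitset) defined by primitive recursion on j. Then
-- g (n + 1) counts the codes below the bound whose bit is set at stage n and at no earlier stage.
-- All of this is written in a term language with bounded sums and iteration, whose terms compile
-- to primitive recursive functions. Over the empty alphabet only the empty string exists.

open import Defs
open import Data.Empty using (⊥-elim)
open import Data.Fin using (Fin; zero; suc; toℕ; fromℕ<)
open import Data.Fin.Properties using (toℕ<n; toℕ-fromℕ<; toℕ-injective)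
open import Data.List using (List; []; _∷_; _++_; length; map; replicate)
open import Data.List.Properties using (length-++; length-map; length-replicate)
open import Data.List.Membership.Propositional using (_∈_)
open import Data.List.Membership.Propositional.Properties using (∈-++⁻; ∈-++⁺ˡ; ∈-++⁺ʳ; ∈-map⁻; ∈-map⁺)
open import Data.List.Relation.Unary.All using ([])
open import Data.List.Relation.Unary.AllPairs using ([]; _∷_)
open import Data.List.Relation.Unary.Any using (here; there)
open import Data.List.Relation.Unary.Unique.Propositional using (Unique)
import Data.List.Relation.Unary.Unique.Propositional.Properties as Unique
open import Data.Nat using (ℕ; zero; suc; _+_; _*_; _∸_; _⊔_; pred; _≤_; _<_; _<?_; z≤n; s≤s; z<s; s≤s⁻¹)
open import Data.Nat.DivMod using (_/_; _%_; m%n<n; m/n≤m; m≡m%n+[m/n]*n; +-distrib-/; m<n⇒m/n≡0; m*n/n≡m; m<n⇒m%n≡m; m*n%n≡0; [m+kn]%n≡m%n)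
open import Data.Nat.Properties
open import Data.Nat.Tactic.RingSolver using (solve-∀)
open import Data.Product using (Σ; _×_; _,_; proj₁; proj₂; ∃-syntax)
open import Data.Sum using (_⊎_; inj₁; inj₂)
open import Data.Vec using (Vec; []; _∷_; lookup; tabulate)
open import Data.Vec.Properties using (tabulate∘lookup)
open import Function using (id; _∘_)
open import Function.Bundles using (mk⇔)
open import Relation.Binary.Definitions using (tri<; tri≈; tri>)
open import Relation.Binary.PropositionalEquality
open import Relation.Nullary using (¬_; yes; no)

natrec : ℕ → ℕ → (ℕ → ℕ → ℕ) → ℕ
natrec zero    z s = z
natrec (suc n) z s = s n (natrec n z s)

natrec-cong : ∀ n z {s s′ : ℕ → ℕ → ℕ} → (∀ i a → s i a ≡ s′ i a) →
              natrec n z s ≡ natrec n z s′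
natrec-cong zero    z eq = refl
natrec-cong (suc n) z {s′ = s′} eq = trans (eq n _) (cong (s′ n) (natrec-cong n z eq))

sumBelow : ℕ → (ℕ → ℕ) → ℕ
sumBelow n f = natrec n 0 (λ i acc → acc + f i)

infixl 6 _⊕_ _⊖_
infixl 7 _⊗_

data Expr : ℕ → Set where
  var         : ∀ {n} → Fin n → Expr n
  lit         : ∀ {n} → ℕ → Expr n
  _⊕_ _⊗_ _⊖_ : ∀ {n} → Expr n → Expr n → Expr n
  bsum        : ∀ {n} → Expr n → Expr (suc n) → Expr n
  brec        : ∀ {n} → Expr n → Expr n → Expr (suc (suc n)) → Expr n
  call        : ∀ {m n} → Expr m → Vec (Expr n) m → Expr n

mutual
  ⟦_⟧ : ∀ {n} → Expr n → Vec ℕ n → ℕ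
  ⟦ var i ⟧      xs = lookup xs i
  ⟦ lit c ⟧      xs = c
  ⟦ a ⊕ b ⟧      xs = ⟦ a ⟧ xs + ⟦ b ⟧ xs
  ⟦ a ⊗ b ⟧      xs = ⟦ a ⟧ xs * ⟦ b ⟧ xs
  ⟦ a ⊖ b ⟧      xs = ⟦ a ⟧ xs ∸ ⟦ b ⟧ xs
  ⟦ bsum b e ⟧   xs = sumBelow (⟦ b ⟧ xs) (λ i → ⟦ e ⟧ (i ∷ xs))
  ⟦ brec c b s ⟧ xs = natrec (⟦ c ⟧ xs) (⟦ b ⟧ xs) (λ i a → ⟦ s ⟧ (i ∷ a ∷ xs))
  ⟦ call f es ⟧  xs = ⟦ f ⟧ (⟦ es ⟧* xs)

  ⟦_⟧* : ∀ {m n} → Vec (Expr n) m → Vec ℕ n → Vec ℕ m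
  ⟦ [] ⟧*     xs = []
  ⟦ e ∷ es ⟧* xs = ⟦ e ⟧ xs ∷ ⟦ es ⟧* xs

constPR : ∀ {n} → ℕ → PR n
constPR zero    = zeroF
constPR (suc c) = comp succF (constPR c ∷ [])

constPR-correct : ∀ {n} c (xs : Vec ℕ n) → eval (constPR c) xs ≡ c
constPR-correct zero    xs = refl
constPR-correct (suc c) xs = cong suc (constPR-correct c xs)

addPR : PR 2
addPR = prec (proj zero) (comp succF (proj (suc zero) ∷ []))

addPR-correct : ∀ x y → eval addPR (x ∷ y ∷ []) ≡ x + y
addPR-correct zero    y = refl
addPR-correct (suc x) y = cong suc (addPR-correct x y)

mulPR : PR 2
mulPR = prec zeroF (comp addPR (proj (suc (suc zero)) ∷ proj (suc zero) ∷ []))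

mulPR-correct : ∀ x y → eval mulPR (x ∷ y ∷ []) ≡ x * y
mulPR-correct zero    y = refl
mulPR-correct (suc x) y =
  trans (addPR-correct y (eval mulPR (x ∷ y ∷ []))) (cong (y +_) (mulPR-correct x y))

predPR : PR 1
predPR = prec zeroF (proj zero)

predPR-correct : ∀ x → eval predPR (x ∷ []) ≡ pred x
predPR-correct zero    = refl
predPR-correct (suc x) = refl

monusPR : PR 2
monusPR = prec (proj zero) (comp predPR (proj (suc zero) ∷ []))

monusPR-correct : ∀ y x → eval monusPR (y ∷ x ∷ []) ≡ x ∸ y
monusPR-correct zero    x = refl
monusPR-correct (suc y) x = begin
  eval predPR (eval monusPR (y ∷ x ∷ []) ∷ [])  ≡⟨ predPR-correct (eval monusPR (y ∷ x ∷ [])) ⟩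
  pred (eval monusPR (y ∷ x ∷ []))              ≡⟨ cong pred (monusPR-correct y x) ⟩
  pred (x ∸ y)                                  ≡⟨ pred[m∸n]≡m∸[1+n] x y ⟩
  x ∸ suc y                                     ∎
  where open ≡-Reasoning

projs : ∀ {m n} → (Fin m → Fin n) → Vec (PR n) m
projs ρ = tabulate (proj ∘ ρ)

evalVec-projs : ∀ {m n} (ρ : Fin m → Fin n) xs →
                evalVec (projs ρ) xs ≡ tabulate (lookup xs ∘ ρ)
evalVec-projs {zero}  ρ xs = refl
evalVec-projs {suc m} ρ xs = cong (lookup xs (ρ zero) ∷_) (evalVec-projs (ρ ∘ suc) xs)

idPRs : ∀ {n} → Vec (PR n) n
idPRs = projs id

evalVec-idPRs : ∀ {n} (xs : Vec ℕ n) → evalVec idPRs xs ≡ xs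
evalVec-idPRs xs = trans (evalVec-projs id xs) (tabulate∘lookup xs)

dropTwoPRs : ∀ {n} → Vec (PR (suc (suc n))) n
dropTwoPRs = projs λ i → suc (suc i)

evalVec-dropTwoPRs : ∀ {n} y a (xs : Vec ℕ n) → evalVec dropTwoPRs (y ∷ a ∷ xs) ≡ xs
evalVec-dropTwoPRs y a xs = trans (evalVec-projs _ (y ∷ a ∷ xs)) (tabulate∘lookup xs)

recPR : ∀ {n} → PR n → PR n → PR (suc (suc n)) → PR n
recPR c b s = comp (prec b s) (c ∷ idPRs)

recPR-correct : ∀ {n} (c b : PR n) s xs →
  eval (recPR c b s) xs ≡ natrec (eval c xs) (eval b xs) (λ i a → eval s (i ∷ a ∷ xs))
recPR-correct c b s xs =
  trans (cong (λ ys → eval (prec b s) (eval c xs ∷ ys)) (evalVec-idPRs xs)) (prec-natrec (eval c xs))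
  where
  prec-natrec : ∀ y → eval (prec b s) (y ∷ xs) ≡ natrec y (eval b xs) (λ i a → eval s (i ∷ a ∷ xs))
  prec-natrec zero    = refl
  prec-natrec (suc y) = cong (λ a → eval s (y ∷ a ∷ xs)) (prec-natrec y)

accumulatePR : ∀ {n} → PR (suc n) → PR (suc (suc n))
accumulatePR f = comp addPR (proj (suc zero) ∷ comp f (proj zero ∷ dropTwoPRs) ∷ [])

accumulatePR-correct : ∀ {n} (f : PR (suc n)) i a xs →
                       eval (accumulatePR f) (i ∷ a ∷ xs) ≡ a + eval f (i ∷ xs)
accumulatePR-correct f i a xs =
  trans (addPR-correct a _) (cong (λ ys → a + eval f (i ∷ ys)) (evalVec-dropTwoPRs i a xs))

mutual
  compile : ∀ {n} → Expr n → PR n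
  compile (var i)      = proj i
  compile (lit c)      = constPR c
  compile (a ⊕ b)      = comp addPR (compile a ∷ compile b ∷ [])
  compile (a ⊗ b)      = comp mulPR (compile a ∷ compile b ∷ [])
  compile (a ⊖ b)      = comp monusPR (compile b ∷ compile a ∷ [])
  compile (bsum b e)   = recPR (compile b) zeroF (accumulatePR (compile e))
  compile (brec c b s) = recPR (compile c) (compile b) (compile s)
  compile (call f es)  = comp (compile f) (compile* es)

  compile* : ∀ {m n} → Vec (Expr n) m → Vec (PR n) m
  compile* []       = []
  compile* (e ∷ es) = compile e ∷ compile* es

mutual
  compile-correct : ∀ {n} (e : Expr n) xs → eval (compile e) xs ≡ ⟦ e ⟧ xs
  compile-correct (var i)      xs = refl
  compile-correct (lit c)      xs = constPR-correct c xs
  compile-correct (a ⊕ b)      xs = trans (addPR-correct (eval (compile a) xs) (eval (compile b) xs))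
                                         (cong₂ _+_ (compile-correct a xs) (compile-correct b xs))
  compile-correct (a ⊗ b)      xs = trans (mulPR-correct (eval (compile a) xs) (eval (compile b) xs))
                                         (cong₂ _*_ (compile-correct a xs) (compile-correct b xs))
  compile-correct (a ⊖ b)      xs = trans (monusPR-correct (eval (compile b) xs) (eval (compile a) xs))
                                         (cong₂ _∸_ (compile-correct a xs) (compile-correct b xs))
  compile-correct (bsum b e)   xs =
    trans (recPR-correct (compile b) zeroF (accumulatePR (compile e)) xs)
          (trans (cong (λ c → natrec c 0 _) (compile-correct b xs))
                 (natrec-cong (⟦ b ⟧ xs) 0 λ i a →
                   trans (accumulatePR-correct (compile e) i a xs)
                         (cong (a +_) (compile-correct e (i ∷ xs)))))
  compile-correct (brec c b s) xs =
    trans (recPR-correct (compile c) (compile b) (compile s) xs)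
          (trans (cong₂ (λ c′ b′ → natrec c′ b′ λ i a → eval (compile s) (i ∷ a ∷ xs))
                        (compile-correct c xs) (compile-correct b xs))
                 (natrec-cong (⟦ c ⟧ xs) (⟦ b ⟧ xs) (λ i a → compile-correct s (i ∷ a ∷ xs))))
  compile-correct (call f es)  xs =
    trans (cong (eval (compile f)) (compile*-correct es xs)) (compile-correct f _)

  compile*-correct : ∀ {m n} (es : Vec (Expr n) m) xs → evalVec (compile* es) xs ≡ ⟦ es ⟧* xs
  compile*-correct []       xs = refl
  compile*-correct (e ∷ es) xs = cong₂ _∷_ (compile-correct e xs) (compile*-correct es xs)

⟦⟧-primRecOnPos : (e : Expr 1) → PrimRecOnPos (λ n → ⟦ e ⟧ (n ∷ []))
⟦⟧-primRecOnPos e = compile e , λ n → compile-correct e (suc n ∷ [])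

sumBelow-cong : ∀ n {f g : ℕ → ℕ} → (∀ i → f i ≡ g i) → sumBelow n f ≡ sumBelow n g
sumBelow-cong n eq = natrec-cong n 0 λ i acc → cong (acc +_) (eq i)

sumBelow-suc : ∀ n (f : ℕ → ℕ) → sumBelow (suc n) f ≡ f 0 + sumBelow n (f ∘ suc)
sumBelow-suc zero    f = +-comm 0 (f 0)
sumBelow-suc (suc n) f = trans (cong (_+ f (suc n)) (sumBelow-suc n f)) (+-assoc (f 0) _ _)

sumBelow-+ : ∀ n (f g : ℕ → ℕ) → sumBelow n (λ i → f i + g i) ≡ sumBelow n f + sumBelow n g
sumBelow-+ zero    f g = refl
sumBelow-+ (suc n) f g =
  trans (cong (_+ (f n + g n)) (sumBelow-+ n f g)) (interchange (sumBelow n f) (sumBelow n g) (f n) (g n))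
  where
  interchange : ∀ a b c d → a + b + (c + d) ≡ a + c + (b + d)
  interchange = solve-∀

-- Positive numbers serve as truth values.

m*n>0⇒m>0 : ∀ m n → 0 < m * n → 0 < m
m*n>0⇒m>0 (suc m) n _ = z<s

m*n>0⇒n>0 : ∀ m n → 0 < m * n → 0 < n
m*n>0⇒n>0 m n mn>0 = m*n>0⇒m>0 n m (subst (0 <_) (*-comm m n) mn>0)

m>0∧n>0⇒m*n>0 : ∀ {m n} → 0 < m → 0 < n → 0 < m * n
m>0∧n>0⇒m*n>0 {suc m} {suc n} _ _ = z<s

m+n>0⇒m>0∨n>0 : ∀ m n → 0 < m + n → 0 < m ⊎ 0 < n
m+n>0⇒m>0∨n>0 zero    n n>0 = inj₂ n>0
m+n>0⇒m>0∨n>0 (suc m) n _   = inj₁ z<s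

m>0⇒m+n>0 : ∀ {m} n → 0 < m → 0 < m + n
m>0⇒m+n>0 {m} n m>0 = <-≤-trans m>0 (m≤m+n m n)

n>0⇒m+n>0 : ∀ m {n} → 0 < n → 0 < m + n
n>0⇒m+n>0 m {n} n>0 = <-≤-trans n>0 (m≤n+m n m)

sumBelow>0⇒∃ : ∀ n f → 0 < sumBelow n f → ∃[ i ] (i < n × 0 < f i)
sumBelow>0⇒∃ (suc n) f pos with m+n>0⇒m>0∨n>0 (sumBelow n f) (f n) pos
... | inj₁ pos′ = let i , i<n , fi>0 = sumBelow>0⇒∃ n f pos′ in i , m≤n⇒m≤1+n i<n , fi>0
... | inj₂ fn>0 = n , ≤-refl , fn>0

∃⇒sumBelow>0 : ∀ n f {i} → i < n → 0 < f i → 0 < sumBelow n f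
∃⇒sumBelow>0 (suc n) f {i} i<1+n fi>0 with m≤n⇒m<n∨m≡n (s≤s⁻¹ i<1+n)
... | inj₁ i<n  = m>0⇒m+n>0 (f n) (∃⇒sumBelow>0 n f i<n fi>0)
... | inj₂ refl = n>0⇒m+n>0 (sumBelow n f) fi>0

sumBelow≡0 : ∀ n f → (∀ i → i < n → f i ≡ 0) → sumBelow n f ≡ 0
sumBelow≡0 zero    f _    = refl
sumBelow≡0 (suc n) f f≡0 = cong₂ _+_ (sumBelow≡0 n f λ i i<n → f≡0 i (m≤n⇒m≤1+n i<n)) (f≡0 n ≤-refl)

sg : ℕ → ℕ
sg x = 1 ∸ (1 ∸ x)

sg≤1 : ∀ x → sg x ≤ 1
sg≤1 x = m∸n≤m 1 (1 ∸ x)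

sg>0⇒n>0 : ∀ x → 0 < sg x → 0 < x
sg>0⇒n>0 (suc x) _ = z<s

n>0⇒sg>0 : ∀ {x} → 0 < x → 0 < sg x
n>0⇒sg>0 {suc x} _ rewrite 0∸n≡0 x = z<s

1∸n>0⇒n≡0 : ∀ x → 0 < 1 ∸ x → x ≡ 0
1∸n>0⇒n≡0 zero    _ = refl
1∸n>0⇒n≡0 (suc x) pos = ⊥-elim (n≮0 (subst (0 <_) (0∸n≡0 x) pos))

n≡0⇒1∸n>0 : ∀ {x} → x ≡ 0 → 0 < 1 ∸ x
n≡0⇒1∸n>0 refl = z<s

χ≡ : ℕ → ℕ → ℕ
χ≡ a b = 1 ∸ ((a ∸ b) + (b ∸ a))

χ≡≤1 : ∀ a b → χ≡ a b ≤ 1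
χ≡≤1 a b = m∸n≤m 1 ((a ∸ b) + (b ∸ a))

χ≡>0⇒≡ : ∀ a b → 0 < χ≡ a b → a ≡ b
χ≡>0⇒≡ a b pos = ≤-antisym (m∸n≡0⇒m≤n (m+n≡0⇒m≡0 (a ∸ b) diff≡0))
                           (m∸n≡0⇒m≤n (m+n≡0⇒n≡0 (a ∸ b) diff≡0))
  where diff≡0 = 1∸n>0⇒n≡0 _ pos

χ≡-refl : ∀ a → 0 < χ≡ a a
χ≡-refl a rewrite n∸n≡0 a = z<s

χ≤ : ℕ → ℕ → ℕ
χ≤ a b = 1 ∸ (a ∸ b)

χ≤>0⇒≤ : ∀ a b → 0 < χ≤ a b → a ≤ b
χ≤>0⇒≤ a b pos = m∸n≡0⇒m≤n (1∸n>0⇒n≡0 _ pos)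

≤⇒χ≤>0 : ∀ {a b} → a ≤ b → 0 < χ≤ a b
≤⇒χ≤>0 a≤b rewrite m≤n⇒m∸n≡0 a≤b = z<s

n∸m>0⇒m<n : ∀ m n → 0 < n ∸ m → m < n
n∸m>0⇒m<n m n pos = ≰⇒> λ n≤m → n≮0 (subst (0 <_) (m≤n⇒m∸n≡0 n≤m) pos)

parity : ℕ → ℕ
parity y = natrec y 0 (λ _ p → 1 ∸ p)

-- ⌊ y / 2 ⌋ is the number of odd numbers below y.
half : ℕ → ℕ
half y = sumBelow y parity

shiftRight : ℕ → ℕ → ℕ
shiftRight x S = natrec x S (λ _ a → half a)

bit : ℕ → ℕ → ℕ
bit S x = parity (shiftRight x S)

pow2 : ℕ → ℕ
pow2 w = natrec w 1 (λ _ a → a * 2)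

fromBits : ℕ → (ℕ → ℕ) → ℕ
fromBits B b = sumBelow B (λ w → pow2 w * b w)

parity≤1 : ∀ y → parity y ≤ 1
parity≤1 zero    = z≤n
parity≤1 (suc y) = m∸n≤m 1 (parity y)

parity-double : ∀ T → parity (T + T) ≡ 0
parity-double zero    = refl
parity-double (suc T) rewrite +-suc T T | parity-double T = refl

half-double : ∀ T → half (T + T) ≡ T
half-double zero    = refl
half-double (suc T) rewrite +-suc T T | half-double T | parity-double T =
  trans (cong (_+ 1) (+-identityʳ T)) (+-comm T 1)

parity-digit : ∀ b T → b ≤ 1 → parity (b + (T + T)) ≡ b
parity-digit zero          T _ = parity-double T
parity-digit (suc zero)    T _ rewrite parity-double T = refl
parity-digit (suc (suc b)) T (s≤s ())

half-digit : ∀ b T → b ≤ 1 → half (b + (T + T)) ≡ T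
half-digit zero          T _ = half-double T
half-digit (suc zero)    T _ rewrite half-double T | parity-double T = +-identityʳ T
half-digit (suc (suc b)) T (s≤s ())

shiftRight-half : ∀ x S → shiftRight x (half S) ≡ half (shiftRight x S)
shiftRight-half zero    S = refl
shiftRight-half (suc x) S = cong half (shiftRight-half x S)

shiftRight-0 : ∀ x → shiftRight x 0 ≡ 0
shiftRight-0 zero    = refl
shiftRight-0 (suc x) = cong half (shiftRight-0 x)

bit-suc : ∀ S x → bit S (suc x) ≡ bit (half S) x
bit-suc S x = cong parity (sym (shiftRight-half x S))

bit≤1 : ∀ S x → bit S x ≤ 1
bit≤1 S x = parity≤1 (shiftRight x S)

fromBits-suc : ∀ B b → fromBits (suc B) b ≡ b 0 + (fromBits B (b ∘ suc) + fromBits B (b ∘ suc))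
fromBits-suc B b = begin
  fromBits (suc B) b
    ≡⟨ sumBelow-suc B (λ w → pow2 w * b w) ⟩
  1 * b 0 + sumBelow B (λ w → pow2 w * 2 * b (suc w))
    ≡⟨ cong₂ _+_ (*-identityˡ (b 0)) (sumBelow-cong B λ w → double (pow2 w) (b (suc w))) ⟩
  b 0 + sumBelow B (λ w → pow2 w * b (suc w) + pow2 w * b (suc w))
    ≡⟨ cong (b 0 +_) (sumBelow-+ B _ _) ⟩
  b 0 + (fromBits B (b ∘ suc) + fromBits B (b ∘ suc))
    ∎
  where
  open ≡-Reasoning
  double : ∀ p c → p * 2 * c ≡ p * c + p * c
  double = solve-∀

bit-fromBits-< : ∀ {x} B b → (∀ w → b w ≤ 1) → x < B → bit (fromBits B b) x ≡ b x
bit-fromBits-< {zero} (suc B) b b≤1 _ rewrite fromBits-suc B b =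
  parity-digit (b 0) (fromBits B (b ∘ suc)) (b≤1 0)
bit-fromBits-< {suc x} (suc B) b b≤1 (s≤s x<B)
  rewrite bit-suc (fromBits (suc B) b) x | fromBits-suc B b
        | half-digit (b 0) (fromBits B (b ∘ suc)) (b≤1 0) =
  bit-fromBits-< B (b ∘ suc) (b≤1 ∘ suc) x<B

bit-fromBits-≥ : ∀ {x} B b → (∀ w → b w ≤ 1) → B ≤ x → bit (fromBits B b) x ≡ 0
bit-fromBits-≥ {x}     zero    b b≤1 _ = cong parity (shiftRight-0 x)
bit-fromBits-≥ {suc x} (suc B) b b≤1 (s≤s B≤x)
  rewrite bit-suc (fromBits (suc B) b) x | fromBits-suc B b
        | half-digit (b 0) (fromBits B (b ∘ suc)) (b≤1 0) =
  bit-fromBits-≥ B (b ∘ suc) (b≤1 ∘ suc) B≤x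

bit-fromBits>0⁻ : ∀ B b → (∀ w → b w ≤ 1) → ∀ {x} → 0 < bit (fromBits B b) x → x < B × 0 < b x
bit-fromBits>0⁻ B b b≤1 {x} pos with x <? B
... | yes x<B = x<B , subst (0 <_) (bit-fromBits-< B b b≤1 x<B) pos
... | no  x≮B = ⊥-elim (n≮0 (subst (0 <_) (bit-fromBits-≥ B b b≤1 (≮⇒≥ x≮B)) pos))

bit-fromBits>0⁺ : ∀ B b → (∀ w → b w ≤ 1) → ∀ {x} → x < B → 0 < b x → 0 < bit (fromBits B b) x
bit-fromBits>0⁺ B b b≤1 x<B pos = subst (0 <_) (sym (bit-fromBits-< B b b≤1 x<B)) pos

-- Each expression fE below is chosen so that ⟦ fE ⟧ unfolds definitionally to f; this is why
-- the arithmetic above uses only natrec, sumBelow and the semiring operations with monus.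

x₀ : ∀ {n} → Expr (suc n)
x₀ = var zero

x₁ : ∀ {n} → Expr (suc (suc n))
x₁ = var (suc zero)

x₂ : ∀ {n} → Expr (suc (suc (suc n)))
x₂ = var (suc (suc zero))

x₃ : ∀ {n} → Expr (suc (suc (suc (suc n))))
x₃ = var (suc (suc (suc zero)))

x₄ : ∀ {n} → Expr (suc (suc (suc (suc (suc n)))))
x₄ = var (suc (suc (suc (suc zero))))

sgE : ∀ {n} → Expr n → Expr n
sgE e = lit 1 ⊖ (lit 1 ⊖ e)

χ≡E : ∀ {n} → Expr n → Expr n → Expr n
χ≡E a b = lit 1 ⊖ ((a ⊖ b) ⊕ (b ⊖ a))

χ≤E : ∀ {n} → Expr n → Expr n → Expr n
χ≤E a b = lit 1 ⊖ (a ⊖ b)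

bitE : ∀ {n} → Expr n → Expr n → Expr n
bitE S x = parityE (brec x S (halfE x₁))
  where
  parityE : ∀ {n} → Expr n → Expr n
  parityE e = brec e (lit 0) (lit 1 ⊖ x₁)
  halfE : ∀ {n} → Expr n → Expr n
  halfE e = bsum e (parityE x₀)

fromBitsE : ∀ {n} → Expr n → Expr (suc n) → Expr n
fromBitsE B b = bsum B (brec x₀ (lit 1) (x₁ ⊗ lit 2) ⊗ b)

supportBelow : (ℕ → ℕ) → ℕ → List ℕ
supportBelow f zero    = []
supportBelow f (suc N) = supportBelow f N ++ replicate (f N) N

length-supportBelow : ∀ f N → length (supportBelow f N) ≡ sumBelow N f
length-supportBelow f zero    = refl
length-supportBelow f (suc N) =
  trans (length-++ (supportBelow f N)) (cong₂ _+_ (length-supportBelow f N) (length-replicate (f N)))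

∈-replicate⁻ : ∀ {x a : ℕ} m → x ∈ replicate m a → 0 < m × x ≡ a
∈-replicate⁻ (suc m) (here x≡a)  = z<s , x≡a
∈-replicate⁻ (suc m) (there x∈) = z<s , proj₂ (∈-replicate⁻ m x∈)

∈-supportBelow⁻ : ∀ f N {x} → x ∈ supportBelow f N → x < N × 0 < f x
∈-supportBelow⁻ f (suc N) x∈ with ∈-++⁻ (supportBelow f N) x∈
... | inj₁ x∈′ = let x<N , fx>0 = ∈-supportBelow⁻ f N x∈′ in m≤n⇒m≤1+n x<N , fx>0
... | inj₂ x∈′ with ∈-replicate⁻ (f N) x∈′
...   | fN>0 , refl = ≤-refl , fN>0

∈-supportBelow⁺ : ∀ f N {x} → x < N → 0 < f x → x ∈ supportBelow f N
∈-supportBelow⁺ f (suc N) x<1+N fx>0 with m≤n⇒m<n∨m≡n (s≤s⁻¹ x<1+N)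
... | inj₁ x<N  = ∈-++⁺ˡ (∈-supportBelow⁺ f N x<N fx>0)
... | inj₂ refl = ∈-++⁺ʳ (supportBelow f N) (replicate⁺ (f N) fx>0)
  where
  replicate⁺ : ∀ {a : ℕ} m → 0 < m → a ∈ replicate m a
  replicate⁺ (suc m) _ = here refl

supportBelow-unique : ∀ {f} N → (∀ x → f x ≤ 1) → Unique (supportBelow f N)
supportBelow-unique zero          f≤1 = []
supportBelow-unique {f} (suc N) f≤1 =
  Unique.++⁺ (supportBelow-unique N f≤1) (replicate-unique (f N) (f≤1 N))
    λ (x∈ , x∈′) → <-irrefl (proj₂ (∈-replicate⁻ (f N) x∈′)) (proj₁ (∈-supportBelow⁻ f N x∈))
  where
  replicate-unique : ∀ m → m ≤ 1 → Unique (replicate m N)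
  replicate-unique zero          _ = []
  replicate-unique (suc zero)    _ = [] ∷ []
  replicate-unique (suc (suc m)) (s≤s ())

-- Strings over Fin (suc k) as bijective base-(suc k) numerals, least significant digit first.
module StringCode (k : ℕ) where

  K : ℕ
  K = suc k

  encode : Str K → ℕ
  encode []      = 0
  encode (a ∷ s) = suc (toℕ a + K * encode s)

  powK : ℕ → ℕ
  powK p = natrec p 1 (λ _ a → a * K)

  powK>0 : ∀ p → 0 < powK p
  powK>0 zero    = z<s
  powK>0 (suc p) = <-≤-trans (powK>0 p) (m≤m*n (powK p) K)

  encode-++ : ∀ x z → encode (x ++ z) ≡ encode x + powK (length x) * encode z
  encode-++ []      z = sym (+-identityʳ (encode z))
  encode-++ (a ∷ x) z = cong suc (begin
    toℕ a + K * encode (x ++ z)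
      ≡⟨ cong (λ e → toℕ a + K * e) (encode-++ x z) ⟩
    toℕ a + K * (encode x + powK (length x) * encode z)
      ≡⟨ distribute (toℕ a) K (encode x) (powK (length x)) (encode z) ⟩
    toℕ a + K * encode x + powK (length x) * K * encode z
      ∎)
    where
    open ≡-Reasoning
    distribute : ∀ a k e p z → a + k * (e + p * z) ≡ a + k * e + p * k * z
    distribute = solve-∀

  encode-++-≤ˡ : ∀ x z → encode x ≤ encode (x ++ z)
  encode-++-≤ˡ x z = subst (encode x ≤_) (sym (encode-++ x z)) (m≤m+n _ _)

  encode-++-≤ʳ : ∀ x z → encode z ≤ encode (x ++ z)
  encode-++-≤ʳ x z = subst (encode z ≤_) (sym (encode-++ x z)) (begin
    encode z                             ≡⟨ *-identityˡ (encode z) ⟨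
    1 * encode z                         ≤⟨ *-monoˡ-≤ (encode z) (powK>0 (length x)) ⟩
    powK (length x) * encode z           ≤⟨ m≤n+m _ (encode x) ⟩
    encode x + powK (length x) * encode z ∎)
    where open ≤-Reasoning

  -- The codes of the strings of length p form the interval [codeStart p , codeStart (suc p)).
  codeStart : ℕ → ℕ
  codeStart p = natrec p 0 (λ _ a → suc (K * a))

  codeStart≤encode : ∀ s → codeStart (length s) ≤ encode s
  codeStart≤encode []      = z≤n
  codeStart≤encode (a ∷ s) = s≤s (≤-trans (*-monoʳ-≤ K (codeStart≤encode s)) (m≤n+m _ (toℕ a)))

  encode<codeStart : ∀ s → encode s < codeStart (suc (length s))
  encode<codeStart []      = z<s
  encode<codeStart (a ∷ s) = s≤s (begin
    suc (toℕ a + K * encode s)     ≤⟨ +-monoˡ-≤ (K * encode s) (toℕ<n a) ⟩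
    K + K * encode s               ≡⟨ *-suc K (encode s) ⟨
    K * suc (encode s)             ≤⟨ *-monoʳ-≤ K (encode<codeStart s) ⟩
    K * codeStart (suc (length s)) ∎)
    where open ≤-Reasoning

  codeStart-mono : ∀ {p q} → p ≤ q → codeStart p ≤ codeStart q
  codeStart-mono {q = zero}  z≤n   = ≤-refl
  codeStart-mono {q = suc q} p≤1+q with m≤n⇒m<n∨m≡n p≤1+q
  ... | inj₁ p<1+q = ≤-trans (codeStart-mono (s≤s⁻¹ p<1+q)) (m≤n⇒m≤1+n (m≤n*m (codeStart q) K))
  ... | inj₂ refl  = ≤-refl

  length≡ : ∀ s {p} → codeStart p ≤ encode s → encode s < codeStart (suc p) → length s ≡ p
  length≡ s {p} lower upper with <-cmp (length s) p
  ... | tri≈ _ eq _ = eq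
  ... | tri< lt _ _ = ⊥-elim (<-irrefl refl
          (<-≤-trans (encode<codeStart s) (≤-trans (codeStart-mono lt) lower)))
  ... | tri> _ _ gt = ⊥-elim (<-irrefl refl
          (<-≤-trans upper (≤-trans (codeStart-mono gt) (codeStart≤encode s))))

  encode<encode-∷ : ∀ a s → encode s < encode (a ∷ s)
  encode<encode-∷ a s = s≤s (≤-trans (m≤n*m (encode s) K) (m≤n+m _ (toℕ a)))

  length≤encode : ∀ s → length s ≤ encode s
  length≤encode []      = z≤n
  length≤encode (a ∷ s) = ≤-trans (s≤s (length≤encode s)) (encode<encode-∷ a s)

  -- Structural recursion on the fuel f; any f ≥ x suffices.
  decodeWithin : ℕ → ℕ → Str K
  decodeWithin zero    _       = []
  decodeWithin (suc f) zero    = []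
  decodeWithin (suc f) (suc y) = fromℕ< (m%n<n y K) ∷ decodeWithin f (y / K)

  decode : ℕ → Str K
  decode x = decodeWithin x x

  encode-decodeWithin : ∀ f x → x ≤ f → encode (decodeWithin f x) ≡ x
  encode-decodeWithin zero    zero    _ = refl
  encode-decodeWithin (suc f) zero    _ = refl
  encode-decodeWithin (suc f) (suc y) (s≤s y≤f) = cong suc (begin
    toℕ (fromℕ< (m%n<n y K)) + K * encode (decodeWithin f (y / K))
      ≡⟨ cong₂ (λ a b → a + K * b) (toℕ-fromℕ< (m%n<n y K))
                                   (encode-decodeWithin f (y / K) (≤-trans (m/n≤m y K) y≤f)) ⟩
    y % K + K * (y / K)  ≡⟨ cong (y % K +_) (*-comm K (y / K)) ⟩
    y % K + y / K * K    ≡⟨ m≡m%n+[m/n]*n y K ⟨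
    y                    ∎)
    where open ≡-Reasoning

  encode-decode : ∀ x → encode (decode x) ≡ x
  encode-decode x = encode-decodeWithin x x ≤-refl

  digit+K*n/K≡n : ∀ a n → a < K → (a + K * n) / K ≡ n
  digit+K*n/K≡n a n a<K = begin
    (a + K * n) / K    ≡⟨ cong (λ z → (a + z) / K) (*-comm K n) ⟩
    (a + n * K) / K    ≡⟨ +-distrib-/ a (n * K) no-carry ⟩
    a / K + n * K / K  ≡⟨ cong₂ _+_ (m<n⇒m/n≡0 a<K) (m*n/n≡m n K) ⟩
    n                  ∎
    where
    open ≡-Reasoning
    no-carry : a % K + (n * K) % K < K
    no-carry = subst (_< K) (sym (trans (cong₂ _+_ (m<n⇒m%n≡m a<K) (m*n%n≡0 n K)) (+-identityʳ a))) a<K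

  digit+K*n%K≡digit : ∀ a n → a < K → (a + K * n) % K ≡ a
  digit+K*n%K≡digit a n a<K =
    trans (cong (λ z → (a + z) % K) (*-comm K n)) (trans ([m+kn]%n≡m%n a n K) (m<n⇒m%n≡m a<K))

  decodeWithin-encode : ∀ f s → encode s ≤ f → decodeWithin f (encode s) ≡ s
  decodeWithin-encode zero    []      _ = refl
  decodeWithin-encode (suc f) []      _ = refl
  decodeWithin-encode (suc f) (a ∷ s) (s≤s le) = cong₂ _∷_
    (toℕ-injective (trans (toℕ-fromℕ< (m%n<n (toℕ a + K * encode s) K))
                          (digit+K*n%K≡digit (toℕ a) (encode s) (toℕ<n a))))
    (trans (cong (decodeWithin f) (digit+K*n/K≡n (toℕ a) (encode s) (toℕ<n a)))
           (decodeWithin-encode f s (≤-trans (s≤s⁻¹ (encode<encode-∷ a s)) le)))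

  decode-encode : ∀ s → decode (encode s) ≡ s
  decode-encode s = decodeWithin-encode (encode s) s ≤-refl

  decode-injective : ∀ {x y} → decode x ≡ decode y → x ≡ y
  decode-injective {x} {y} eq = trans (sym (encode-decode x)) (trans (cong encode eq) (encode-decode y))

module Rewriting (k : ℕ) where

  open StringCode k

  χlength : ℕ → ℕ → ℕ
  χlength p x = χ≤ (codeStart p) x * (codeStart (suc p) ∸ x)

  χlength>0⇒length≡ : ∀ p x → 0 < χlength p x → length (decode x) ≡ p
  χlength>0⇒length≡ p x pos = length≡ (decode x)
    (subst (codeStart p ≤_) (sym (encode-decode x)) (χ≤>0⇒≤ _ _ (m*n>0⇒m>0 lower _ pos)))
    (subst (_< codeStart (suc p)) (sym (encode-decode x)) (n∸m>0⇒m<n _ _ (m*n>0⇒n>0 lower _ pos)))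
    where lower = χ≤ (codeStart p) x

  χlength-encode>0 : ∀ s → 0 < χlength (length s) (encode s)
  χlength-encode>0 s = m>0∧n>0⇒m*n>0 (≤⇒χ≤>0 (codeStart≤encode s)) (m<n⇒0<n∸m (encode<codeStart s))

  spliceCode : ℕ → ℕ → Str K → ℕ → ℕ
  spliceCode p ex r ey = ex + powK p * (encode r + powK (length r) * ey)

  encode-splice : ∀ x r y → encode (x ++ r ++ y) ≡ spliceCode (length x) (encode x) r (encode y)
  encode-splice x r y =
    trans (encode-++ x (r ++ y)) (cong (λ z → encode x + powK (length x) * z) (encode-++ r y))

  decode-spliceCode : ∀ {p} ex r ey → length (decode ex) ≡ p →
                      decode (spliceCode p ex r ey) ≡ decode ex ++ r ++ decode ey
  decode-spliceCode ex r ey refl = begin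
    decode (spliceCode (length X) ex r ey)
      ≡⟨ cong₂ (λ a b → decode (spliceCode (length X) a r b)) (encode-decode ex) (encode-decode ey) ⟨
    decode (spliceCode (length X) (encode X) r (encode Y))
      ≡⟨ cong decode (encode-splice X r Y) ⟨
    decode (encode (X ++ r ++ Y))
      ≡⟨ decode-encode (X ++ r ++ Y) ⟩
    X ++ r ++ Y
      ∎
    where
    open ≡-Reasoning
    X = decode ex
    Y = decode ey

  Rewrites : Str K → Str K → Str K → Str K → Set
  Rewrites r t u v = ∃[ x ] ∃[ y ] (u ≡ x ++ r ++ y × v ≡ x ++ t ++ y)

  -- The split point and the codes of the prefix and the suffix never exceed v.
  χrule : Str K → Str K → ℕ → ℕ → ℕ
  χrule r t v w = sumBelow (suc v) λ p → sumBelow (suc v) λ ex → sumBelow (suc v) λ ey →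
    χlength p ex * χ≡ v (spliceCode p ex r ey) * χ≡ w (spliceCode p ex t ey)

  χrule-sound : ∀ r t v w → 0 < χrule r t v w → Rewrites r t (decode v) (decode w)
  χrule-sound r t v w pos =
    let p , _ , pos₁ = sumBelow>0⇒∃ (suc v) _ pos
        ex , _ , pos₂ = sumBelow>0⇒∃ (suc v) _ pos₁
        ey , _ , pos₃ = sumBelow>0⇒∃ (suc v) _ pos₂
        len , hv , hw = factors (χlength p ex) _ _ pos₃
        lengthX = χlength>0⇒length≡ p ex len
    in decode ex , decode ey
     , trans (cong decode (χ≡>0⇒≡ v _ hv)) (decode-spliceCode ex r ey lengthX)
     , trans (cong decode (χ≡>0⇒≡ w _ hw)) (decode-spliceCode ex t ey lengthX)
    where
    factors : ∀ a b c → 0 < a * b * c → 0 < a × 0 < b × 0 < c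
    factors a b c abc>0 = m*n>0⇒m>0 a b ab>0 , m*n>0⇒n>0 a b ab>0 , m*n>0⇒n>0 (a * b) c abc>0
      where ab>0 = m*n>0⇒m>0 (a * b) c abc>0

  χrule-complete : ∀ {r t u v} → Rewrites r t u v → 0 < χrule r t (encode u) (encode v)
  χrule-complete {r} {t} (x , y , refl , refl) =
    ∃⇒sumBelow>0 (suc c) _ (s≤s p≤c) (∃⇒sumBelow>0 (suc c) _ (s≤s ex≤c) (∃⇒sumBelow>0 (suc c) _ (s≤s ey≤c)
      (m>0∧n>0⇒m*n>0 (m>0∧n>0⇒m*n>0 (χlength-encode>0 x) (matches r)) (matches t))))
    where
    c = encode (x ++ r ++ y)
    matches : ∀ q → 0 < χ≡ (encode (x ++ q ++ y)) (spliceCode (length x) (encode x) q (encode y))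
    matches q = subst (λ z → 0 < χ≡ z spliced) (sym (encode-splice x q y)) (χ≡-refl spliced)
      where spliced = spliceCode (length x) (encode x) q (encode y)
    ex≤c = encode-++-≤ˡ x (r ++ y)
    p≤c = ≤-trans (length≤encode x) ex≤c
    ey≤c = ≤-trans (encode-++-≤ʳ r y) (encode-++-≤ʳ x (r ++ y))

  codeStartE : ∀ {n} → Expr n → Expr n
  codeStartE e = brec e (lit 0) (lit 1 ⊕ lit K ⊗ x₁)

  χlengthE : ∀ {n} → Expr n → Expr n → Expr n
  χlengthE p x = χ≤E (codeStartE p) x ⊗ (codeStartE (lit 1 ⊕ p) ⊖ x)

  spliceCodeE : ∀ {n} → Expr n → Expr n → Str K → Expr n → Expr n
  spliceCodeE p ex r ey = ex ⊕ brec p (lit 1) (x₁ ⊗ lit K) ⊗ (lit (encode r) ⊕ lit (powK (length r)) ⊗ ey)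

  χruleE : Str K → Str K → Expr 2
  χruleE r t = bsum (lit 1 ⊕ x₀) (bsum (lit 1 ⊕ x₁) (bsum (lit 1 ⊕ x₂)
    (χlengthE x₂ x₁ ⊗ χ≡E x₃ (spliceCodeE x₂ x₁ r x₀) ⊗ χ≡E x₄ (spliceCodeE x₂ x₁ t x₀))))

  -- Summing over the rule list on the syntax side keeps the final expression
  -- definitionally equal to its meaning, although the rule list is a variable.
  χrulesE : List (Str K × Str K) → Expr 2
  χrulesE []             = lit 0
  χrulesE ((r , t) ∷ rs) = χruleE r t ⊕ χrulesE rs

  χrules : List (Str K × Str K) → ℕ → ℕ → ℕ
  χrules rs v w = ⟦ χrulesE rs ⟧ (v ∷ w ∷ [])

  χrules-sound : ∀ rs v w → 0 < χrules rs v w →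
                 ∃[ r ] ∃[ t ] ((r , t) ∈ rs × Rewrites r t (decode v) (decode w))
  χrules-sound ((r , t) ∷ rs) v w pos with m+n>0⇒m>0∨n>0 (χrule r t v w) _ pos
  ... | inj₁ pos′ = r , t , here refl , χrule-sound r t v w pos′
  ... | inj₂ pos′ = let r′ , t′ , r′t′∈rs , rw = χrules-sound rs v w pos′ in r′ , t′ , there r′t′∈rs , rw

  χrules-complete : ∀ {rs r t u v} → (r , t) ∈ rs → Rewrites r t u v →
                    0 < χrules rs (encode u) (encode v)
  χrules-complete {(r , t) ∷ rs} (here refl) rw = m>0⇒m+n>0 _ (χrule-complete rw)
  χrules-complete {(r′ , t′) ∷ rs} {u = u} {v} (there rt∈rs) rw =
    n>0⇒m+n>0 (χrule r′ t′ (encode u) (encode v)) (χrules-complete rt∈rs rw)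

module Evolution (k : ℕ) (M : MultiwaySystem (suc k)) where

  open StringCode k
  open Rewriting k

  χstep : ℕ → ℕ → ℕ
  χstep = χrules (rules M)

  χstep-sound : ∀ {v w} → 0 < χstep v w → Step M (decode v) (decode w)
  χstep-sound {v} {w} pos =
    let r , t , rt∈rules , x , y , eq₁ , eq₂ = χrules-sound (rules M) v w pos
    in r , t , x , y , rt∈rules , eq₁ , eq₂

  χstep-complete : ∀ {u v} → Step M u v → 0 < χstep (encode u) (encode v)
  χstep-complete (r , t , x , y , rt∈rules , eq₁ , eq₂) = χrules-complete rt∈rules (x , y , eq₁ , eq₂)

  maxRhsLength : List (Str K × Str K) → ℕ
  maxRhsLength []             = 0
  maxRhsLength ((r , t) ∷ rs) = length t ⊔ maxRhsLength rs

  length≤maxRhsLength : ∀ {rs r t} → (r , t) ∈ rs → length t ≤ maxRhsLength rs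
  length≤maxRhsLength {(r , t) ∷ rs}   (here refl)   = m≤m⊔n (length t) (maxRhsLength rs)
  length≤maxRhsLength {(r′ , t′) ∷ rs} (there rt∈rs) =
    ≤-trans (length≤maxRhsLength rt∈rs) (m≤n⊔m (length t′) (maxRhsLength rs))

  D : ℕ
  D = maxRhsLength (rules M)

  Step⇒length≤ : ∀ {u v} → Step M u v → length v ≤ length u + D
  Step⇒length≤ (r , t , x , y , rt∈rules , refl , refl) = begin
    length (x ++ t ++ y)                        ≡⟨ length-++ x ⟩
    length x + length (t ++ y)                  ≡⟨ cong (length x +_) (length-++ t) ⟩
    length x + (length t + length y)            ≡⟨ rearrange (length x) (length t) (length y) ⟩
    length x + length y + length t              ≤⟨ +-mono-≤ (+-monoʳ-≤ (length x) (m≤n+m (length y) (length r)))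
                                                             (length≤maxRhsLength rt∈rules) ⟩
    length x + (length r + length y) + D        ≡⟨ cong (λ l → length x + l + D) (length-++ r) ⟨
    length x + length (r ++ y) + D              ≡⟨ cong (_+ D) (length-++ x) ⟨
    length (x ++ r ++ y) + D                    ∎
    where
    open ≤-Reasoning
    rearrange : ∀ a b c → a + (b + c) ≡ a + c + b
    rearrange a b c = trans (cong (a +_) (+-comm b c)) (sym (+-assoc a c b))

  Path⇒length≤ : ∀ {j s} → Path M j (init M) s → length s ≤ length (init M) + j * D
  Path⇒length≤ here = m≤m+n _ 0
  Path⇒length≤ {suc j} {s} (step {v = u} p st) = begin
    length s                              ≤⟨ Step⇒length≤ st ⟩
    length u + D                          ≤⟨ +-monoˡ-≤ D (Path⇒length≤ p) ⟩
    length (init M) + j * D + D           ≡⟨ +-assoc (length (init M)) (j * D) D ⟩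
    length (init M) + (j * D + D)         ≡⟨ cong (length (init M) +_) (+-comm (j * D) D) ⟩
    length (init M) + suc j * D           ∎
    where open ≤-Reasoning

  codeBound : ℕ → ℕ
  codeBound j = codeStart (suc (length (init M) + j * D))

  Path⇒encode<codeBound : ∀ {j s} → Path M j (init M) s → encode s < codeBound j
  Path⇒encode<codeBound {s = s} p =
    <-≤-trans (encode<codeStart s) (codeStart-mono (s≤s (Path⇒length≤ p)))

  -- Bit x of reachable j is set iff decode x is reachable in exactly j steps.
  initialBits : ℕ → ℕ
  initialBits w = χ≡ w (encode (init M))

  successorBits : ℕ → ℕ → ℕ → ℕ
  successorBits j S w = sg (sumBelow (codeBound j) λ v → bit S v * χstep v w)

  reachable : ℕ → ℕ
  reachable j = natrec j (fromBits (codeBound 0) initialBits)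
                         (λ i S → fromBits (codeBound (suc i)) (successorBits i S))

  initialBits≤1 : ∀ w → initialBits w ≤ 1
  initialBits≤1 w = χ≡≤1 w (encode (init M))

  successorBits≤1 : ∀ j S w → successorBits j S w ≤ 1
  successorBits≤1 j S w = sg≤1 (sumBelow (codeBound j) λ v → bit S v * χstep v w)

  reachable-sound : ∀ j x → 0 < bit (reachable j) x → Path M j (init M) (decode x)
  reachable-sound zero x pos =
    let _ , x≡init = bit-fromBits>0⁻ (codeBound 0) initialBits initialBits≤1 pos
    in subst (Path M 0 (init M))
             (sym (trans (cong decode (χ≡>0⇒≡ x _ x≡init)) (decode-encode (init M)))) here
  reachable-sound (suc j) x pos =
    let _ , hit = bit-fromBits>0⁻ (codeBound (suc j)) _ (successorBits≤1 j (reachable j)) pos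
        v , _ , pos′ = sumBelow>0⇒∃ (codeBound j) _ (sg>0⇒n>0 _ hit)
    in step (reachable-sound j v (m*n>0⇒m>0 _ _ pos′)) (χstep-sound (m*n>0⇒n>0 (bit (reachable j) v) _ pos′))

  reachable-complete : ∀ {j s} → Path M j (init M) s → 0 < bit (reachable j) (encode s)
  reachable-complete here =
    bit-fromBits>0⁺ (codeBound 0) initialBits initialBits≤1 (Path⇒encode<codeBound here) (χ≡-refl (encode (init M)))
  reachable-complete {suc j} (step {v = u} p st) =
    bit-fromBits>0⁺ (codeBound (suc j)) _ (successorBits≤1 j (reachable j)) (Path⇒encode<codeBound (step p st))
      (n>0⇒sg>0 (∃⇒sumBelow>0 (codeBound j) _ (Path⇒encode<codeBound p)
        (m>0∧n>0⇒m*n>0 (reachable-complete p) (χstep-complete st))))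

  χgeneration : ℕ → ℕ → ℕ
  χgeneration n x = bit (reachable n) x * (1 ∸ sumBelow n λ j → bit (reachable j) x)

  χgeneration≤1 : ∀ n x → χgeneration n x ≤ 1
  χgeneration≤1 n x = *-mono-≤ (bit≤1 (reachable n) x) (m∸n≤m 1 (sumBelow n λ j → bit (reachable j) x))

  χgeneration>0⇒Dist : ∀ n x → 0 < χgeneration n x → Dist M (decode x) n
  χgeneration>0⇒Dist n x pos = reachable-sound n x (m*n>0⇒m>0 _ _ pos) , earlier-unreachable
    where
    earlier≡0 : sumBelow n (λ j → bit (reachable j) x) ≡ 0
    earlier≡0 = 1∸n>0⇒n≡0 _ (m*n>0⇒n>0 (bit (reachable n) x) _ pos)
    earlier-unreachable : ∀ j → j < n → ¬ Path M j (init M) (decode x)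
    earlier-unreachable j j<n p = n≮0 (subst (0 <_) earlier≡0 (∃⇒sumBelow>0 n _ j<n
      (subst (λ y → 0 < bit (reachable j) y) (encode-decode x) (reachable-complete p))))

  Dist⇒χgeneration>0 : ∀ {n s} → Dist M s n → 0 < χgeneration n (encode s)
  Dist⇒χgeneration>0 {n} {s} (p , shortest) =
    m>0∧n>0⇒m*n>0 (reachable-complete p) (n≡0⇒1∸n>0 (sumBelow≡0 n _ λ j j<n → n≤0⇒n≡0 (≮⇒≥ λ pos →
      shortest j j<n (subst (Path M j (init M)) (decode-encode s) (reachable-sound j (encode s) pos)))))

  count : ℕ → ℕ
  count n = sumBelow (codeBound n) (χgeneration n)

  growthIs-count : ∀ n → GrowthIs M (suc n) (count n)
  growthIs-count n = map decode codes
                   , Unique.map⁺ decode-injective (supportBelow-unique (codeBound n) (χgeneration≤1 n))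
                   , trans (length-map decode codes) (length-supportBelow (χgeneration n) (codeBound n))
                   , λ s → mk⇔ sound (complete s)
    where
    codes = supportBelow (χgeneration n) (codeBound n)
    sound : ∀ {s} → s ∈ map decode codes → Dist M s n
    sound s∈ with ∈-map⁻ decode s∈
    ... | x , x∈ , refl = χgeneration>0⇒Dist n x (proj₂ (∈-supportBelow⁻ (χgeneration n) (codeBound n) x∈))
    complete : ∀ s → Dist M s n → s ∈ map decode codes
    complete s d = subst (_∈ map decode codes) (decode-encode s)
      (∈-map⁺ decode (∈-supportBelow⁺ (χgeneration n) (codeBound n) (Path⇒encode<codeBound (proj₁ d)) (Dist⇒χgeneration>0 d)))

  codeBoundE : ∀ {n} → Expr n → Expr n
  codeBoundE j = codeStartE (lit 1 ⊕ (lit (length (init M)) ⊕ j ⊗ lit D))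

  reachableE : Expr 1
  reachableE = brec x₀ (fromBitsE (codeBoundE (lit 0)) (χ≡E x₀ (lit (encode (init M)))))
    (fromBitsE (codeBoundE (lit 1 ⊕ x₀))
      (sgE (bsum (codeBoundE x₁) (bitE x₃ x₀ ⊗ call (χrulesE (rules M)) (x₀ ∷ x₁ ∷ [])))))

  countE : Expr 1
  countE = bsum (codeBoundE x₀)
    (bitE (call reachableE (x₁ ∷ [])) x₀ ⊗ (lit 1 ⊖ bsum x₁ (bitE (call reachableE (x₀ ∷ [])) x₁)))

  growthE : Expr 1
  growthE = call countE ((x₀ ⊖ lit 1) ∷ [])

  ⟦growthE⟧≡count : ∀ n → ⟦ growthE ⟧ (suc n ∷ []) ≡ count n
  ⟦growthE⟧≡count n = refl

module EmptyAlphabet (M : MultiwaySystem 0) where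

  ≡[] : (s : Str 0) → s ≡ []
  ≡[] []      = refl
  ≡[] (() ∷ _)

  initial : ∀ s → Path M 0 (init M) s
  initial s = subst (Path M 0 (init M)) (trans (≡[] (init M)) (sym (≡[] s))) here

  growthE : Expr 1
  growthE = lit 1 ⊖ (x₀ ⊖ lit 1)

  growthIs-growthE : ∀ n → GrowthIs M (suc n) (⟦ growthE ⟧ (suc n ∷ []))
  growthIs-growthE zero = [] ∷ [] , [] ∷ [] , refl , λ s →
    mk⇔ (λ { (here refl) → initial [] , λ _ () }) (λ _ → here (≡[] s))
  growthIs-growthE (suc n) = [] , [] , sym (0∸n≡0 n) , λ s →
    mk⇔ (λ ()) (λ dist → ⊥-elim (proj₂ dist 0 (s≤s z≤n) (initial s)))

lemma5 : ∀ {k} (M : MultiwaySystem k) →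
  Σ (ℕ → ℕ) (λ g → ((n : ℕ) → GrowthIs M (suc n) (g (suc n))) × PrimRecOnPos g)
lemma5 {zero} M = (λ m → ⟦ growthE ⟧ (m ∷ [])) , growthIs-growthE , ⟦⟧-primRecOnPos growthE
  where open EmptyAlphabet M
lemma5 {suc k} M = (λ m → ⟦ growthE ⟧ (m ∷ []))
                 , (λ n → subst (GrowthIs M (suc n)) (sym (⟦growthE⟧≡count n)) (growthIs-count n))
                 , ⟦⟧-primRecOnPos growthE
  where open Evolution k M
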